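{- Let $S$ be a sorting sequence with $r>1$ distinct values and multiplicities $p_1,\dots,p_r$, let $c=\gcd(p_1,\dots,p_r)$, and let $(f_1,\dots,f_r)$ be a general solution for $S$. Suppose that for some $i\in\{1,\dots,r-1\}$ we have $f_{i+1}>f_i+(p_i+p_{i+1})/c$. Apply the redistribution procedure: replace $f_{i+1}$ by $f_{i+1}-p_i/c$ (removing $p_i/c$ fake coins from each of the $p_{i+1}$ piles marked $i$) and $f_i$ by $f_i+p_{i+1}/c$ (adding $p_{i+1}/c$ fake coins to each of the $p_i$ piles marked $i-1$), leaving all other $f_j$ unchanged. Then the resulting tuple is again a general solution for $S$.
   Context: A sorting sequence of length $p$ is a non-decreasing sequence of $p$ non-negative integers beginning with $0$ in which each entry equals the previous one or exceeds it by $1$ (recording the outcome of sorting $p$ piles of coins by weight, fake coins lighter). If its distinct entries are $0,\dots,r-1$, let $p_i\ge1$ be the number of entries equal to $i-1$. A general solution with $f$ fake coins is an integer tuple $(f_1,\dots,f_r)$ with $0\le f_1<\dots<f_r$ and $\sum_ip_if_i=f$ ($f_i$ = number of fake coins in each pile marked $i-1$). -}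

module Defs where

open import Data.Nat using (ℕ; zero; suc; _+_; _*_; _∸_; _<_; _⊔_; _/_)
open import Data.Nat.GCD using (gcd)
open import Data.Fin using (Fin; toℕ; _≟_)
open import Data.List using (List; []; _∷_; map; foldr; allFin; length)
open import Data.Nat.ListAction using (sum)
open import Data.Bool using (true; false; if_then_else_)
open import Data.Product using (_×_)
open import Data.Sum using (_⊎_)
open import Relation.Binary.PropositionalEquality using (_≡_)
open import Relation.Nullary using (yes; no)
open import Relation.Nullary.Decidable using (does)
import Data.Nat as ℕ

data Steps : ℕ → List ℕ → Set where
  done : ∀ {x} → Steps x []
  same : ∀ {x xs} → Steps x xs → Steps x (x ∷ xs)
  up   : ∀ {x xs} → Steps (suc x) xs → Steps x (suc x ∷ xs)

IsSortingSeq : List ℕ → Set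
IsSortingSeq []       = Data.Nat.zero ≡ suc zero
IsSortingSeq (x ∷ xs) = (x ≡ 0) × Steps x xs

-- number r of distinct values (= maximum entry + 1 for a sorting sequence)
numValues : List ℕ → ℕ
numValues S = suc (foldr _⊔_ 0 S)

count : ℕ → List ℕ → ℕ
count v []       = 0
count v (x ∷ xs) = if does (v ℕ.≟ x) then suc (count v xs) else count v xs

-- multiplicity p_{j+1} = number of entries equal to j (0-indexed j : Fin r)
mult : (S : List ℕ) → Fin (numValues S) → ℕ
mult S j = count (toℕ j) S

gcdMult : List ℕ → ℕ
gcdMult S = foldr gcd 0 (map (mult S) (allFin (numValues S)))

-- division, total: m div 0 = 0 (only used with divisor c ≥ 1)
_div_ : ℕ → ℕ → ℕ
m div zero    = 0
m div (suc k) = m / suc k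

weightedSum : (S : List ℕ) → (Fin (numValues S) → ℕ) → ℕ
weightedSum S f = sum (map (λ j → mult S j * f j) (allFin (numValues S)))

-- general solution with n fake coins (entries are naturals, hence ≥ 0)
GeneralSolution : (S : List ℕ) → ℕ → (Fin (numValues S) → ℕ) → Set
GeneralSolution S n f =
  (∀ (j k : Fin (numValues S)) → toℕ j < toℕ k → f j < f k) × (weightedSum S f ≡ n)

-- redistribution at adjacent positions a (paper's i) and b (paper's i+1)
redistribute : (S : List ℕ) → (f : Fin (numValues S) → ℕ) →
               (a b : Fin (numValues S)) → Fin (numValues S) → ℕ
redistribute S f a b j =
  if does (j ≟ b) then f b ∸ (mult S a div gcdMult S)
  else (if does (j ≟ a) then f a + (mult S b div gcdMult S) else f j)

-- Moving p_{i+1}/c coins onto each pile marked i-1 and p_i/c coins off each pile marked i changes the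
-- total by p_i (p_{i+1}/c) - p_{i+1} (p_i/c) = 0, since c divides both multiplicities. The value f_i
-- only grows and f_{i+1} only shrinks, so monotonicity can only fail between them, and the gap
-- hypothesis f_i + (p_i + p_{i+1})/c < f_{i+1} says exactly that the new values stay strictly ordered.
module Submission where

open import Defs
open import Data.Nat using (ℕ; suc; _+_; _<_)
open import Data.Fin using (Fin; toℕ)
open import Data.List using (List)
open import Relation.Binary.PropositionalEquality using (_≡_)

open import Data.Nat using (zero; _*_; _∸_; _≤_; _/_; s≤s⁻¹)
open import Data.Nat.Properties
  using (+-comm; +-assoc; +-identityʳ; *-comm; *-distribˡ-+; +-cancelʳ-≡; n<1+n; n≮n; ≤-refl;
         <-trans; ≤-<-trans; <-≤-trans; ≤∧≢⇒<; m≤m+n; m∸n≤m; m∸n+n≡m; m+n≤o⇒n≤o; m+n≤o⇒m≤o∸n;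
         +-commutativeSemigroup)
open import Algebra.Properties.CommutativeSemigroup +-commutativeSemigroup
  renaming (interchange to +-interchange)
open import Data.Nat.GCD using (gcd; gcd[m,n]∣m; gcd[m,n]∣n)
open import Data.Nat.Divisibility using (_∣_; ∣-trans)
open import Data.Nat.DivMod using (+-distrib-/-∣ˡ; *-/-assoc)
open import Data.Fin using (zero; suc; _≟_)
open import Data.Fin.Properties using (toℕ-injective)
open import Data.List using (_∷_; []; map; foldr; allFin; tabulate)
open import Data.List.Properties using (map-tabulate; map-cong)
open import Data.Nat.ListAction using (sum)
open import Data.List.Membership.Propositional using (_∈_)
open import Data.List.Membership.Propositional.Properties using (∈-map⁺; ∈-allFin)
open import Data.List.Relation.Unary.Any using (here; there)
open import Data.Bool using (if_then_else_)
open import Data.Product using (_,_)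
open import Relation.Nullary using (yes; no; contradiction)
open import Relation.Nullary.Decidable using (does)
open import Relation.Binary.PropositionalEquality
  using (_≢_; refl; sym; trans; cong; cong₂; subst; subst₂; module ≡-Reasoning)

open ≡-Reasoning

foldr-gcd-∣ : ∀ {x} (xs : List ℕ) → x ∈ xs → foldr gcd 0 xs ∣ x
foldr-gcd-∣ (y ∷ xs) (here refl) = gcd[m,n]∣m y (foldr gcd 0 xs)
foldr-gcd-∣ (y ∷ xs) (there x∈xs) = ∣-trans (gcd[m,n]∣n y (foldr gcd 0 xs)) (foldr-gcd-∣ xs x∈xs)

gcdMult-∣-mult : (S : List ℕ) (j : Fin (numValues S)) → gcdMult S ∣ mult S j
gcdMult-∣-mult S j = foldr-gcd-∣ _ (∈-map⁺ (mult S) (∈-allFin j))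

+-distrib-div-∣ˡ : ∀ {c m} n → c ∣ m → (m + n) div c ≡ m div c + n div c
+-distrib-div-∣ˡ {zero}  n c∣m = refl
+-distrib-div-∣ˡ {suc _} n c∣m = +-distrib-/-∣ˡ n c∣m

*-div-comm : ∀ {c m n} → c ∣ m → c ∣ n → m * (n div c) ≡ n * (m div c)
*-div-comm {zero}  {m} {n} _ _ = trans (*-comm m 0) (*-comm 0 n)
*-div-comm {suc k} {m} {n} c∣m c∣n = begin
  m * (n / suc k)  ≡⟨ *-/-assoc m c∣n ⟨
  m * n / suc k    ≡⟨ cong (_/ suc k) (*-comm m n) ⟩
  n * m / suc k    ≡⟨ *-/-assoc n c∣m ⟩
  n * (m / suc k)  ∎

StrictlyIncreasing : ∀ {n} → (Fin n → ℕ) → Set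
StrictlyIncreasing f = ∀ j k → toℕ j < toℕ k → f j < f k

module _ {n} {a b : Fin n} (adjacent : toℕ b ≡ suc (toℕ a)) where

  adjacent⇒≢ : a ≢ b
  adjacent⇒≢ refl = n≮n (toℕ a) (subst (toℕ a <_) (sym adjacent) (n<1+n (toℕ a)))

  <-adjacentˡ : ∀ {j} → toℕ j < toℕ b → j ≢ a → toℕ j < toℕ a
  <-adjacentˡ {j} j<b j≢a =
    ≤∧≢⇒< (s≤s⁻¹ (subst (toℕ j <_) adjacent j<b)) (λ e → j≢a (toℕ-injective e))

  <-adjacentʳ : ∀ {k} → toℕ a < toℕ k → k ≢ b → toℕ b < toℕ k
  <-adjacentʳ {k} a<k k≢b =
    ≤∧≢⇒< (subst (_≤ toℕ k) (sym adjacent) a<k) (λ e → k≢b (toℕ-injective (sym e)))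

  -- g may exceed f only at a and fall below f only at b, so only the pair (a, b) needs checking.
  increasing-adjacent-shift : {f g : Fin n → ℕ} → StrictlyIncreasing f →
    (∀ j → j ≢ a → g j ≤ f j) → (∀ j → j ≢ b → f j ≤ g j) → g a < g b →
    StrictlyIncreasing g
  increasing-adjacent-shift {f} {g} f↑ g≤f f≤g ga<gb j k j<k with j ≟ a | k ≟ b
  ... | yes refl | yes refl = ga<gb
  ... | yes refl | no k≢b = <-trans ga<gb (≤-<-trans (g≤f b b≢a) (<-≤-trans (f↑ b k b<k) (f≤g k k≢b)))
    where b<k = <-adjacentʳ j<k k≢b
          b≢a = λ b≡a → adjacent⇒≢ (sym b≡a)
  ... | no j≢a | yes refl = <-trans (≤-<-trans (g≤f j j≢a) (<-≤-trans (f↑ j a j<a) (f≤g a a≢b))) ga<gb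
    where j<a = <-adjacentˡ j<k j≢a
          a≢b = adjacent⇒≢
  ... | no j≢a | no k≢b = ≤-<-trans (g≤f j j≢a) (<-≤-trans (f↑ j k j<k) (f≤g k k≢b))

pointMass : ∀ {n} → Fin n → ℕ → Fin n → ℕ
pointMass b x j = if does (j ≟ b) then x else 0

sum-tabulate-pointMass : ∀ {n} (b : Fin n) x → sum (tabulate (pointMass b x)) ≡ x
sum-tabulate-pointMass {suc n} zero    x = trans (cong (x +_) (sum-zeros n)) (+-identityʳ x)
  where
  sum-zeros : ∀ m → sum (tabulate {n = m} (λ _ → 0)) ≡ 0
  sum-zeros zero    = refl
  sum-zeros (suc m) = sum-zeros m
sum-tabulate-pointMass {suc n} (suc b) x = sum-tabulate-pointMass b x

sum-pointMass : ∀ {n} (b : Fin n) x → sum (map (pointMass b x) (allFin n)) ≡ x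
sum-pointMass b x = trans (cong sum (map-tabulate (λ j → j) (pointMass b x))) (sum-tabulate-pointMass b x)

sum-map-+ : ∀ {A : Set} (u v : A → ℕ) (xs : List A) →
            sum (map (λ j → u j + v j) xs) ≡ sum (map u xs) + sum (map v xs)
sum-map-+ u v []       = refl
sum-map-+ u v (x ∷ xs) = trans (cong (u x + v x +_) (sum-map-+ u v xs))
                                 (+-interchange (u x) (v x) (sum (map u xs)) (sum (map v xs)))

-- Adding t at b to u and t at a to v makes the two functions equal pointwise.
sum-transfer : ∀ {n} (u v : Fin n → ℕ) {a b : Fin n} (t : ℕ) → a ≢ b →
               u a ≡ v a + t → u b + t ≡ v b → (∀ j → j ≢ a → j ≢ b → u j ≡ v j) →
               sum (map u (allFin n)) ≡ sum (map v (allFin n))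
sum-transfer {n} u v {a} {b} t a≢b at-a at-b elsewhere = +-cancelʳ-≡ t _ _ (begin
  Σ u + t                               ≡⟨ cong (Σ u +_) (sum-pointMass b t) ⟨
  Σ u + Σ (pointMass b t)               ≡⟨ sum-map-+ u (pointMass b t) (allFin n) ⟨
  Σ (λ j → u j + pointMass b t j)       ≡⟨ cong sum (map-cong balanced (allFin n)) ⟩
  Σ (λ j → v j + pointMass a t j)       ≡⟨ sum-map-+ v (pointMass a t) (allFin n) ⟩
  Σ v + Σ (pointMass a t)               ≡⟨ cong (Σ v +_) (sum-pointMass a t) ⟩
  Σ v + t                               ∎)
  where
  Σ : (Fin n → ℕ) → ℕ
  Σ h = sum (map h (allFin n))
  balanced : ∀ j → u j + pointMass b t j ≡ v j + pointMass a t j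
  balanced j with j ≟ b | j ≟ a
  ... | yes refl | yes refl = contradiction refl a≢b
  ... | yes refl | no _     = trans at-b (sym (+-identityʳ (v j)))
  ... | no _     | yes refl = trans (+-identityʳ (u j)) at-a
  ... | no j≢b   | no j≢a   = cong₂ _+_ (elsewhere j j≢a j≢b) refl

module _ (S : List ℕ) (f : Fin (numValues S) → ℕ) {a b : Fin (numValues S)} where

  private
    g = redistribute S f a b

  redistribute-at-b : g b ≡ f b ∸ (mult S a div gcdMult S)
  redistribute-at-b with b ≟ b
  ... | yes _   = refl
  ... | no b≢b  = contradiction refl b≢b

  redistribute-at-a : a ≢ b → g a ≡ f a + (mult S b div gcdMult S)
  redistribute-at-a a≢b with a ≟ b | a ≟ a
  ... | yes a≡b | _       = contradiction a≡b a≢b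
  ... | no _    | yes _   = refl
  ... | no _    | no a≢a  = contradiction refl a≢a

  redistribute-elsewhere : ∀ j → j ≢ a → j ≢ b → g j ≡ f j
  redistribute-elsewhere j j≢a j≢b with j ≟ b | j ≟ a
  ... | yes j≡b | _       = contradiction j≡b j≢b
  ... | no _    | yes j≡a = contradiction j≡a j≢a
  ... | no _    | no _    = refl

  redistribute-≤ : ∀ j → j ≢ a → g j ≤ f j
  redistribute-≤ j j≢a with j ≟ b | j ≟ a
  ... | yes refl | _       = m∸n≤m (f j) (mult S a div gcdMult S)
  ... | no _     | yes j≡a = contradiction j≡a j≢a
  ... | no _     | no _    = ≤-refl

  redistribute-≥ : ∀ j → j ≢ b → f j ≤ g j
  redistribute-≥ j j≢b with j ≟ b | j ≟ a
  ... | yes j≡b | _        = contradiction j≡b j≢b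
  ... | no _    | yes refl = m≤m+n (f j) _
  ... | no _    | no _     = ≤-refl

  weightedSum-redistribute : a ≢ b → mult S a div gcdMult S ≤ f b →
                             weightedSum S g ≡ weightedSum S f
  weightedSum-redistribute a≢b da≤fb =
    sum-transfer (λ j → mult S j * g j) (λ j → mult S j * f j) (pa * db) a≢b at-a at-b
      (λ j j≢a j≢b → cong (mult S j *_) (redistribute-elsewhere j j≢a j≢b))
    where
    pa = mult S a
    pb = mult S b
    da = pa div gcdMult S
    db = pb div gcdMult S
    at-a : pa * g a ≡ pa * f a + pa * db
    at-a = trans (cong (pa *_) (redistribute-at-a a≢b)) (*-distribˡ-+ pa (f a) db)
    at-b : pb * g b + pa * db ≡ pb * f b
    at-b = begin
      pb * g b + pa * db         ≡⟨ cong₂ _+_ (cong (pb *_) redistribute-at-b)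
                                              (*-div-comm (gcdMult-∣-mult S a) (gcdMult-∣-mult S b)) ⟩
      pb * (f b ∸ da) + pb * da  ≡⟨ *-distribˡ-+ pb (f b ∸ da) da ⟨
      pb * (f b ∸ da + da)       ≡⟨ cong (pb *_) (m∸n+n≡m da≤fb) ⟩
      pb * f b                   ∎

mainTheorem18 : (S : List ℕ) → IsSortingSeq S → 1 < numValues S →
    (n : ℕ) (f : Fin (numValues S) → ℕ) → GeneralSolution S n f →
    (a b : Fin (numValues S)) → toℕ b ≡ suc (toℕ a) →
    f a + ((mult S a + mult S b) div gcdMult S) < f b →
    GeneralSolution S n (redistribute S f a b)
mainTheorem18 S _ _ n f (f↑ , total) a b adjacent gap =
    increasing-adjacent-shift adjacent f↑ (redistribute-≤ S f) (redistribute-≥ S f) ga<gb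
  , trans (weightedSum-redistribute S f (adjacent⇒≢ adjacent) (m+n≤o⇒n≤o (suc (f a + db)) gap′)) total
  where
  da = mult S a div gcdMult S
  db = mult S b div gcdMult S
  gap′ : suc (f a + db) + da ≤ f b
  gap′ = subst (λ s → suc s ≤ f b)
    (trans (cong (f a +_) (trans (+-distrib-div-∣ˡ (mult S b) (gcdMult-∣-mult S a)) (+-comm da db)))
           (sym (+-assoc (f a) db da)))
    gap
  ga<gb : redistribute S f a b a < redistribute S f a b b
  ga<gb = subst₂ _<_ (sym (redistribute-at-a S f (adjacent⇒≢ adjacent))) (sym (redistribute-at-b S f))
                     (m+n≤o⇒m≤o∸n (suc (f a + db)) gap′)
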